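{- Let $n\ge 1$ and let $\mathbf{x}=(\mathbf{x}_1,\ldots,\mathbf{x}_n)$ be a proper transient vector. Let $\mathrm{xor}$, $\mathrm{or}$, $\mathrm{and}$ denote the $n$-variable boolean functions $x_1\oplus\cdots\oplus x_n$, $x_1+\cdots+x_n$ and $x_1\cdots x_n$. Then $$c_{\mathrm{xor}}(\mathbf{x})=0,$$ $$c_{\mathrm{or}}(\mathbf{x})=(u(\alpha(\mathbf{x}))\ominus 1)+(u(\omega(\mathbf{x}))\ominus 1),$$ $$c_{\mathrm{and}}(\mathbf{x})=(z(\alpha(\mathbf{x}))\ominus 1)+(z(\omega(\mathbf{x}))\ominus 1).$$
   Context: $B=\{0,1\}$. A transient is a nonempty word $\mathbf{t}=t_1\cdots t_m$ over $B$ in which consecutive letters differ; $\alpha(\mathbf{t})=t_1$, $\omega(\mathbf{t})=t_m$, $\Delta(\mathbf{t})=m-1$. The contraction of a nonempty binary word is obtained by deleting every letter equal to the letter immediately preceding it. A transient vector is $\mathbf{x}=(\mathbf{x}_1,\ldots,\mathbf{x}_n)$ with each $\mathbf{x}_i$ a transient; $\Delta(\mathbf{x})=\sum_i\Delta(\mathbf{x}_i)$, $\alpha(\mathbf{x})=(\alpha(\mathbf{x}_1),\ldots,\alpha(\mathbf{x}_n))\in B^n$, $\omega(\mathbf{x})=(\omega(\mathbf{x}_1),\ldots,\omega(\mathbf{x}_n))\in B^n$. $\mathbf{x}$ is proper if $\Delta(\mathbf{x}_i)\ge 1$ for all $i$. For a binary vector $b\in B^n$, $u(b)$ is the number of coordinates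 equal to $1$ and $z(b)$ the number equal to $0$. For integers, $m\ominus k=m-k$ if $m\ge k$ and $0$ otherwise. Transient extension: for $f:B^n\to B$ and a transient vector $\mathbf{x}$, a prefix of $\mathbf{x}$ is a vector $(\mathbf{p}_1,\ldots,\mathbf{p}_n)$ with each $\mathbf{p}_i$ a nonempty prefix of $\mathbf{x}_i$. The digraph $D_f(\mathbf{x})$ has the prefixes of $\mathbf{x}$ as vertices and an arc from $\mathbf{u}$ to $\mathbf{v}$ whenever $\mathbf{v}$ is obtained from $\mathbf{u}$ by appending one letter to exactly one component; each vertex $\mathbf{v}$ gets label $\lambda(\mathbf{v})=f(\omega(\mathbf{v}))$. For a directed path $P=\mathbf{v}^1,\ldots,\mathbf{v}^r$ from $\alpha(\mathbf{x})$ (the vector of first letters) to $\mathbf{x}$, let $\lambda(P)=\lambda(\mathbf{v}^1)\cdots\lambda(\mathbf{v}^r)$. The extension $\mathbf{f}(\mathbf{x})$ is the contraction of $\lambda(P)$ of maximal length over all such paths $P$. The cost of $\mathbf{x}$ for $f$ is $c_f(\mathbf{x})=\Delta(\mathbf{x})-\Delta(\mathbf{f}(\mathbf{x}))$. -}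

module Defs where

open import Data.Bool using (Bool; true; false; _∧_; _∨_; _xor_; if_then_else_)
open import Data.Bool.Properties using () renaming (_≟_ to _≟B_)
open import Data.Nat using (ℕ; zero; suc; _+_; _∸_; _≤_; _<_)
open import Data.Fin using (Fin)
open import Data.List using (List; []; _∷_; length)
open import Data.Product using (Σ; ∃; _×_; _,_)
open import Data.Vec.Functional using (foldr)
open import Relation.Binary.PropositionalEquality using (_≡_; _≢_)
open import Relation.Nullary using (yes; no)

-- B = Bool (false = 0, true = 1); words over B are lists of Bool.

data Alternating : List Bool → Set where
  alt[]  : Alternating []
  alt[_] : ∀ a → Alternating (a ∷ [])
  alt∷   : ∀ {a b w} → a ≢ b → Alternating (b ∷ w) → Alternating (a ∷ b ∷ w)

data NonEmpty : List Bool → Set where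
  ne : ∀ a w → NonEmpty (a ∷ w)

record Transient : Set where
  constructor transient
  field
    word     : List Bool
    nonempty : NonEmpty word
    alternating : Alternating word
open Transient public

-- letter at position i (0-based), default false outside the word
at : List Bool → ℕ → Bool
at []      _       = false
at (a ∷ w) zero    = a
at (a ∷ w) (suc i) = at w i

firstL : List Bool → Bool
firstL []      = false
firstL (a ∷ _) = a

lastL : List Bool → Bool
lastL []          = false
lastL (a ∷ [])    = a
lastL (_ ∷ b ∷ w) = lastL (b ∷ w)

Δt : Transient → ℕ
Δt t = length (word t) ∸ 1

contractFrom : Bool → List Bool → List Bool
contractFrom p []      = []
contractFrom p (b ∷ w) with b ≟B p
... | yes _ = contractFrom p w
... | no  _ = b ∷ contractFrom b w

contraction : List Bool → List Bool
contraction []      = []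
contraction (a ∷ w) = a ∷ contractFrom a w

TVec : ℕ → Set
TVec n = Fin n → Transient

sumF : ∀ {n} → (Fin n → ℕ) → ℕ
sumF v = foldr _+_ 0 v

Δ : ∀ {n} → TVec n → ℕ
Δ x = sumF (λ i → Δt (x i))

α : ∀ {n} → TVec n → (Fin n → Bool)
α x i = firstL (word (x i))

ω : ∀ {n} → TVec n → (Fin n → Bool)
ω x i = lastL (word (x i))

Proper : ∀ {n} → TVec n → Set
Proper x = ∀ i → 1 ≤ Δt (x i)

u : ∀ {n} → (Fin n → Bool) → ℕ
u b = sumF (λ i → if b i then 1 else 0)

z : ∀ {n} → (Fin n → Bool) → ℕ
z b = sumF (λ i → if b i then 0 else 1)

BoolFun : ℕ → Set
BoolFun n = (Fin n → Bool) → Bool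

xorF orF andF : ∀ {n} → BoolFun n
xorF b = foldr _xor_ false b
orF  b = foldr _∨_ false b
andF b = foldr _∧_ true b

-- The digraph D_f(x).  A prefix (p_1,…,p_n) of x, p_i a nonempty prefix
-- of x_i, is represented by its vector of lengths k with 1 ≤ k i ≤ |x_i|.
Vertex : ℕ → Set
Vertex n = Fin n → ℕ

IsPrefix : ∀ {n} → TVec n → Vertex n → Set
IsPrefix x k = ∀ i → 1 ≤ k i × k i ≤ length (word (x i))

ωv : ∀ {n} → TVec n → Vertex n → (Fin n → Bool)
ωv x k i = at (word (x i)) (k i ∸ 1)

Arc : ∀ {n} → Vertex n → Vertex n → Set
Arc {n} k k' = Σ (Fin n) λ i → (k' i ≡ suc (k i)) × (∀ j → j ≢ i → k' j ≡ k j)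

data Consecutive {n} : List (Vertex n) → Set where
  c[]  : Consecutive []
  c[_] : ∀ k → Consecutive (k ∷ [])
  c∷   : ∀ {k k' ks} → Arc k k' → Consecutive (k' ∷ ks) → Consecutive (k ∷ k' ∷ ks)

data AllV {n} (P : Vertex n → Set) : List (Vertex n) → Set where
  a[] : AllV P []
  a∷  : ∀ {k ks} → P k → AllV P ks → AllV P (k ∷ ks)

firstV lastV : ∀ {n} → List (Vertex n) → Vertex n → Set
firstV []       v = NonEmpty []
firstV (k ∷ _)  v = ∀ i → k i ≡ v i
lastV  []            v = NonEmpty []
lastV  (k ∷ [])      v = ∀ i → k i ≡ v i
lastV  (_ ∷ k' ∷ ks) v = lastV (k' ∷ ks) v

startV fullV : ∀ {n} → TVec n → Vertex n
startV x i = 1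
fullV x i = length (word (x i))

record Path {n} (x : TVec n) : Set where
  field
    verts   : List (Vertex n)
    prefixes : AllV (IsPrefix x) verts
    arcs    : Consecutive verts
    starts  : firstV verts (startV x)
    ends    : lastV verts (fullV x)
open Path public

mapL : ∀ {A B : Set} → (A → B) → List A → List B
mapL f []       = []
mapL f (a ∷ as) = f a ∷ mapL f as

labels : ∀ {n} → BoolFun n → (x : TVec n) → Path x → List Bool
labels f x P = mapL (λ k → f (ωv x k)) (verts P)

Δpath : ∀ {n} → BoolFun n → (x : TVec n) → Path x → ℕ
Δpath f x P = length (contraction (labels f x P)) ∸ 1

-- c_f(x) = c  :  the maximum of Δ(contraction λ(P)) over all paths P
-- (= Δ(f(x))) equals Δ(x) − c, i.e. it is attained and bounds every path.
HasCost : ∀ {n} → BoolFun n → TVec n → ℕ → Set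
HasCost f x c =
  (Σ (Path x) λ P → Δpath f x P + c ≡ Δ x) ×
  (∀ (P : Path x) → Δpath f x P + c ≤ Δ x)

-- Every arc of D_f(x) appends a letter to one coordinate, so every path from α(x) to x has
-- exactly Δ(x) arcs and each arc flips exactly one letter of ω; hence xor changes its label at
-- every arc. Up to negation, or and and are the test "no current letter equals p" for p = 1 and
-- p = 0. It changes only when the number c of hot coordinates (current letter p) moves between
-- 0 and 1, and c moves by at most one per arc, so before the first change c descends from c(α)
-- to 1 and after the last one it climbs from 1 to c(ω): (c(α) ∸ 1) + (c(ω) ∸ 1) arcs are wasted
-- (and if nothing changes, properness bounds this by Δ(x)). A greedy path wastes no more: it cools hot
-- coordinates until c = 0, then alternately heats a coordinate with at least two letters left
-- and cools a hot one, and finally finishes the coordinates with one letter left. Its potential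
-- Φ, the number of arcs it is still going to waste, drops at every arc that changes nothing.

module Submission where

open import Defs
open import Data.Bool using (Bool; true; false; not; _xor_; if_then_else_)
open import Data.Bool.Properties
  using (xor-same; not-¬; ¬-not; not-distribˡ-xor; not-distribʳ-xor)
  renaming (_≟_ to _≟B_)
open import Data.Fin using (Fin; zero; suc)
open import Data.Fin.Properties using (punchInᵢ≢i; any?) renaming (_≟_ to _≟F_)
import Data.Fin.Properties as FinP
open import Data.List using (List; []; _∷_; length)
open import Data.List.Relation.Unary.Linked using (Linked; []; [-]; _∷_)
open import Data.Nat using (ℕ; zero; suc; _+_; _∸_; _≤_; _<_; z≤n; s≤s; _≤?_; _≟_)
open import Data.Nat.Properties
open import Data.Nat.Tactic.RingSolver using (solve-∀)
open import Algebra.Properties.CommutativeMonoid.Sum +-0-commutativeMonoid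
  using (sum-cong-≗; ∑-distrib-+; sum-remove; sum-replicate-zero)
open import Data.Product using (Σ; ∃; _×_; _,_; proj₁; proj₂)
open import Data.Sum using (_⊎_; inj₁; inj₂)
open import Data.Vec.Functional using (updateAt; removeAt)
open import Data.Vec.Functional.Properties using (updateAt-updates; updateAt-minimal)
open import Function using (_∘_)
open import Relation.Binary.PropositionalEquality
open import Relation.Nullary using (yes; no; contradiction)

sum-update : ∀ {n} (f g : Fin n → ℕ) i → (∀ j → j ≢ i → f j ≡ g j) →
             sumF f + g i ≡ sumF g + f i
sum-update {suc n} f g i f≡g = begin
  sumF f + g i                     ≡⟨ cong (_+ g i) (sum-remove {i = i} f) ⟩
  f i + sumF (removeAt f i) + g i  ≡⟨ cong (λ s → f i + s + g i) (sum-cong-≗ λ j → f≡g _ (punchInᵢ≢i i j))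
                                    ⟩
  f i + sumF (removeAt g i) + g i  ≡⟨ swap (f i) _ (g i) ⟩
  g i + sumF (removeAt g i) + f i  ≡⟨ cong (_+ f i) (sum-remove {i = i} g) ⟨
  sumF g + f i                     ∎
  where
  open ≡-Reasoning
  swap : ∀ a b c → a + b + c ≡ c + b + a
  swap = solve-∀

term≤sum : ∀ {n} (f : Fin n → ℕ) i → f i ≤ sumF f
term≤sum f zero    = m≤m+n _ _
term≤sum f (suc i) = ≤-trans (term≤sum (f ∘ suc) i) (m≤n+m _ _)

sum-mono-≤ : ∀ {n} {f g : Fin n → ℕ} → (∀ i → f i ≤ g i) → sumF f ≤ sumF g
sum-mono-≤ {zero}  f≤g = z≤n
sum-mono-≤ {suc n} f≤g = +-mono-≤ (f≤g zero) (sum-mono-≤ (f≤g ∘ suc))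

sum≡0⇒term≡0 : ∀ {n} (f : Fin n → ℕ) i → sumF f ≡ 0 → f i ≡ 0
sum≡0⇒term≡0 f i Σf≡0 = n≤0⇒n≡0 (subst (f i ≤_) Σf≡0 (term≤sum f i))

sum>0⇒term>0 : ∀ {n} (f : Fin n → ℕ) → 0 < sumF f → ∃ λ i → 0 < f i
sum>0⇒term>0 {suc n} f Σf>0 with f zero in eq
... | suc _ = zero , subst (0 <_) (sym eq) (s≤s z≤n)
... | zero with sum>0⇒term>0 (f ∘ suc) Σf>0
...   | i , fi>0 = suc i , fi>0

+≡+⇒≤suc : ∀ {m n a b} → m + a ≡ n + b → b ≤ 1 → m ≤ suc n
+≡+⇒≤suc {m} {n} {a} {b} eq b≤1 = begin
  m      ≤⟨ m≤m+n m a ⟩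
  m + a  ≡⟨ eq ⟩
  n + b  ≤⟨ +-monoʳ-≤ n b≤1 ⟩
  n + 1  ≡⟨ +-comm n 1 ⟩
  suc n  ∎
  where open ≤-Reasoning

m∸n≡1+[m∸1+n] : ∀ {m n} → n < m → m ∸ n ≡ suc (m ∸ suc n)
m∸n≡1+[m∸1+n] {suc m} {zero}  _         = refl
m∸n≡1+[m∸1+n] {suc m} {suc n} (s≤s n<m) = m∸n≡1+[m∸1+n] n<m

mapL-∘ : ∀ {A B C : Set} (g : B → C) (f : A → B) l → mapL g (mapL f l) ≡ mapL (g ∘ f) l
mapL-∘ g f []      = refl
mapL-∘ g f (a ∷ l) = cong (g (f a) ∷_) (mapL-∘ g f l)

mapL-cong : ∀ {A B : Set} {f g : A → B} → (∀ a → f a ≡ g a) → ∀ l → mapL f l ≡ mapL g l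
mapL-cong f≡g []      = refl
mapL-cong f≡g (a ∷ l) = cong₂ _∷_ (f≡g a) (mapL-cong f≡g l)

length-mapL : ∀ {A B : Set} (f : A → B) l → length (mapL f l) ≡ length l
length-mapL f []      = refl
length-mapL f (_ ∷ l) = cong suc (length-mapL f l)

Linked-mapL : ∀ {A B : Set} {R : A → A → Set} {S : B → B → Set} (f : A → B) →
              (∀ {a b} → R a b → S (f a) (f b)) → ∀ {l} → Linked R l → Linked S (mapL f l)
Linked-mapL f R⇒S []          = []
Linked-mapL f R⇒S [-]         = [-]
Linked-mapL f R⇒S (Rab ∷ Rbl) = R⇒S Rab ∷ Linked-mapL f R⇒S Rbl

last⁺ : ∀ {A : Set} → A → List A → A
last⁺ a []       = a
last⁺ _ (b ∷ bs) = last⁺ b bs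

-- Changes in a Boolean word

changed : Bool → Bool → ℕ
changed a b = if a xor b then 1 else 0

changes : List Bool → ℕ
changes []          = 0
changes (_ ∷ [])    = 0
changes (a ∷ b ∷ w) = changed a b + changes (b ∷ w)

changed-same : ∀ a → changed a a ≡ 0
changed-same a = cong (if_then 1 else 0) (xor-same a)

changed-≢ : ∀ {a b} → a ≢ b → changed a b ≡ 1
changed-≢ {false} {false} a≢b = contradiction refl a≢b
changed-≢ {false} {true}  _   = refl
changed-≢ {true}  {false} _   = refl
changed-≢ {true}  {true}  a≢b = contradiction refl a≢b

changed-not : ∀ a b → changed (not a) (not b) ≡ changed a b
changed-not false false = refl
changed-not false true  = refl
changed-not true  false = refl
changed-not true  true  = refl

length-contractFrom : ∀ a w → length (contractFrom a w) ≡ changes (a ∷ w)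
length-contractFrom a []      = refl
length-contractFrom a (b ∷ w) with b ≟B a
... | yes refl =
  trans (length-contractFrom a w) (cong (_+ changes (a ∷ w)) (sym (changed-same a)))
... | no  b≢a  = cong₂ _+_ (sym (changed-≢ (b≢a ∘ sym))) (length-contractFrom b w)

length-contraction : ∀ w → length (contraction w) ∸ 1 ≡ changes w
length-contraction []      = refl
length-contraction (a ∷ w) = length-contractFrom a w

changes-mapL-not : ∀ {A : Set} (f : A → Bool) l →
                   changes (mapL (not ∘ f) l) ≡ changes (mapL f l)
changes-mapL-not f []          = refl
changes-mapL-not f (_ ∷ [])    = refl
changes-mapL-not f (a ∷ b ∷ l) = cong₂ _+_ (changed-not (f a) (f b)) (changes-mapL-not f (b ∷ l))

changes-alternating : ∀ {w} → Linked _≢_ w → changes w ≡ length w ∸ 1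
changes-alternating []          = refl
changes-alternating [-]         = refl
changes-alternating (a≢b ∷ alt) = cong₂ _+_ (changed-≢ a≢b) (changes-alternating alt)

-- Walks on ℕ with steps of size at most one

isZero : ℕ → Bool
isZero zero    = true
isZero (suc _) = false

WithinOne : ℕ → ℕ → Set
WithinOne m n = m ≤ suc n × n ≤ suc m

changed-isZero-near : ∀ {m m'} → WithinOne m m' →
                      changed (isZero m) (isZero m') + (m' ∸ 1) ≤ suc (m ∸ 1)
changed-isZero-near {zero}        {zero}        _ = z≤n
changed-isZero-near {zero}        {suc zero}    _ = ≤-refl
changed-isZero-near {zero}        {suc (suc _)} (_ , s≤s ())
changed-isZero-near {suc zero}    {zero}        _ = ≤-refl
changed-isZero-near {suc (suc _)} {zero}        (s≤s () , _)
changed-isZero-near {suc _}       {suc _}       (_ , s≤s m'≤m) = m'≤m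

changed-isZero-far : ∀ {m m'} → 2 ≤ m → WithinOne m m' →
                     changed (isZero m) (isZero m') ≡ 0 × m ∸ 1 ≤ suc (m' ∸ 1)
changed-isZero-far {suc zero}    (s≤s ())
changed-isZero-far {suc (suc _)} {zero}  _ (s≤s () , _)
changed-isZero-far {suc (suc _)} {suc _} _ (s≤s m≤m' , _) = refl , m≤m'

changes-isZero-≤ : ∀ {m ms} → Linked WithinOne (m ∷ ms) →
                   changes (mapL isZero (m ∷ ms)) + (last⁺ m ms ∸ 1) ≤ length ms + (m ∸ 1)
changes-isZero-≤ {ms = []}      [-]            = ≤-refl
changes-isZero-≤ {m} {m' ∷ ms} (m~m' ∷ m'~ms) = begin
  D + C + L                   ≡⟨ +-assoc D C L ⟩
  D + (C + L)                 ≤⟨ +-monoʳ-≤ D (changes-isZero-≤ m'~ms) ⟩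
  D + (length ms + (m' ∸ 1))  ≡⟨ shuffle D (length ms) (m' ∸ 1) ⟩
  length ms + (D + (m' ∸ 1))  ≤⟨ +-monoʳ-≤ (length ms) (changed-isZero-near m~m') ⟩
  length ms + suc (m ∸ 1)     ≡⟨ +-suc (length ms) (m ∸ 1) ⟩
  suc (length ms) + (m ∸ 1)   ∎
  where
  open ≤-Reasoning
  D C L : ℕ
  D = changed (isZero m) (isZero m')
  C = changes (mapL isZero (m' ∷ ms))
  L = last⁺ m' ms ∸ 1
  shuffle : ∀ a b c → a + (b + c) ≡ b + (a + c)
  shuffle = solve-∀

drop-zeros : ∀ {c l b} → c + l ≤ b + 0 → c + 0 + l ≤ b
drop-zeros {c} {l} = subst₂ _≤_ (cong (_+ l) (sym (+-identityʳ c))) (+-identityʳ _)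

-- Before its first change isZero must come down from m to 1, after the last one climb from 1.
changes-isZero-bound : ∀ {m ms} → Linked WithinOne (m ∷ ms) →
  changes (mapL isZero (m ∷ ms)) ≡ 0 ⊎
  changes (mapL isZero (m ∷ ms)) + (m ∸ 1) + (last⁺ m ms ∸ 1) ≤ length ms
changes-isZero-bound {ms = []} [-] = inj₁ refl
changes-isZero-bound {zero}     {ms@(_ ∷ _)} m~ms =
  inj₂ (drop-zeros {changes (mapL isZero (0 ∷ ms))} (changes-isZero-≤ m~ms))
changes-isZero-bound {suc zero} {ms@(_ ∷ _)} m~ms =
  inj₂ (drop-zeros {changes (mapL isZero (1 ∷ ms))} (changes-isZero-≤ m~ms))
changes-isZero-bound {suc (suc m)} {m' ∷ ms} (m~m' ∷ m'~ms)
  with changed-isZero-far (s≤s (s≤s z≤n)) m~m' | changes-isZero-bound m'~ms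
... | D≡0 , m∸1≤ | inj₁ C≡0   = inj₁ (cong₂ _+_ D≡0 C≡0)
... | D≡0 , m∸1≤ | inj₂ bound = inj₂ (begin
  D + C + suc m + L        ≡⟨ cong (λ d → d + C + suc m + L) D≡0 ⟩
  C + suc m + L            ≤⟨ +-monoˡ-≤ L (+-monoʳ-≤ C m∸1≤) ⟩
  C + suc (m' ∸ 1) + L     ≡⟨ cong (_+ L) (+-suc C (m' ∸ 1)) ⟩
  suc (C + (m' ∸ 1) + L)   ≤⟨ s≤s bound ⟩
  suc (length ms)          ∎)
  where
  open ≤-Reasoning
  D C L : ℕ
  D = changed false (isZero m')
  C = changes (mapL isZero (m' ∷ ms))
  L = last⁺ m' ms ∸ 1

agree : Bool → Bool → ℕ
agree true  b = if b then 1 else 0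
agree false b = if b then 0 else 1

agree≤1 : ∀ p b → agree p b ≤ 1
agree≤1 true  true  = ≤-refl
agree≤1 true  false = z≤n
agree≤1 false true  = z≤n
agree≤1 false false = ≤-refl

agree-≢ : ∀ p {a b} → a ≢ b → agree p a + agree p b ≡ 1
agree-≢ p {false} {false} a≢b = contradiction refl a≢b
agree-≢ p {true}  {true}  a≢b = contradiction refl a≢b
agree-≢ false {false} {true}  _ = refl
agree-≢ false {true}  {false} _ = refl
agree-≢ true  {false} {true}  _ = refl
agree-≢ true  {true}  {false} _ = refl

count : ∀ {n} → Bool → (Fin n → Bool) → ℕ
count p b = sumF (λ i → agree p (b i))

none : ∀ {n} → Bool → BoolFun n
none p b = isZero (count p b)

count-withinOne : ∀ {n} p {b b' : Fin n → Bool} i → (∀ j → j ≢ i → b' j ≡ b j) →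
                  WithinOne (count p b) (count p b')
count-withinOne p {b} {b'} i same =
  +≡+⇒≤suc (sym swap) (agree≤1 p (b i)) , +≡+⇒≤suc swap (agree≤1 p (b' i))
  where
  swap : count p b' + agree p (b i) ≡ count p b + agree p (b' i)
  swap = sum-update _ _ i (λ j j≢i → cong (agree p) (same j j≢i))

orF≡not-none : ∀ {n} (b : Fin n → Bool) → orF b ≡ not (none true b)
orF≡not-none {zero}  b = refl
orF≡not-none {suc n} b with b zero
... | true  = refl
... | false = orF≡not-none (b ∘ suc)

andF≡none : ∀ {n} (b : Fin n → Bool) → andF b ≡ none false b
andF≡none {zero}  b = refl
andF≡none {suc n} b with b zero
... | true  = andF≡none (b ∘ suc)
... | false = refl

xorF-cong : ∀ {n} {b b' : Fin n → Bool} → (∀ i → b i ≡ b' i) → xorF b ≡ xorF b'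
xorF-cong {zero}  _     = refl
xorF-cong {suc n} b≡b' = cong₂ _xor_ (b≡b' zero) (xorF-cong (b≡b' ∘ suc))

xorF-flip : ∀ {n} {b b' : Fin n → Bool} i → b' i ≡ not (b i) → (∀ j → j ≢ i → b' j ≡ b j) →
            xorF b' ≡ not (xorF b)
xorF-flip {suc n} {b} {b'} zero flip same = begin
  b' zero xor xorF (b' ∘ suc)      ≡⟨ cong₂ _xor_ flip (xorF-cong (λ j → same (suc j) λ ())) ⟩
  not (b zero) xor xorF (b ∘ suc)  ≡⟨ not-distribˡ-xor (b zero) _ ⟨
  not (xorF b)                     ∎
  where open ≡-Reasoning
xorF-flip {suc n} {b} {b'} (suc i) flip same = begin
  b' zero xor xorF (b' ∘ suc)      ≡⟨ cong₂ _xor_ (same zero λ ()) (xorF-flip i flip same′) ⟩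
  b zero xor not (xorF (b ∘ suc))  ≡⟨ not-distribʳ-xor (b zero) _ ⟨
  not (xorF b)                     ∎
  where
  open ≡-Reasoning
  same′ : ∀ j → j ≢ i → b' (suc j) ≡ b (suc j)
  same′ j j≢i = same (suc j) (j≢i ∘ FinP.suc-injective)

at-first : ∀ w → at w 0 ≡ firstL w
at-first []      = refl
at-first (_ ∷ _) = refl

at-last : ∀ w → at w (length w ∸ 1) ≡ lastL w
at-last []          = refl
at-last (_ ∷ [])    = refl
at-last (_ ∷ b ∷ w) = at-last (b ∷ w)

at-alternates : ∀ {w} → Alternating w → ∀ j → suc j < length w → at w (suc j) ≢ at w j
at-alternates alt[ _ ]       _       (s≤s ())
at-alternates (alt∷ a≢b _)   zero    _         = a≢b ∘ sym
at-alternates (alt∷ _ b∷w)   (suc j) (s≤s j<) = at-alternates b∷w j j<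

agree-first+last≤Δ : ∀ p {w} → Alternating w → 1 ≤ length w ∸ 1 →
                     agree p (firstL w) + agree p (lastL w) ≤ length w ∸ 1
agree-first+last≤Δ p (alt∷ a≢b alt[ _ ]) _ = ≤-reflexive (agree-≢ p a≢b)
agree-first+last≤Δ p {a ∷ b ∷ c ∷ w} _ _ =
  +-mono-≤ (agree≤1 p a) (≤-trans (agree≤1 p (lastL (b ∷ c ∷ w))) (s≤s z≤n))

whenZero whenSuc : ℕ → ℕ → ℕ
whenZero zero    a = a
whenZero (suc _) _ = 0
whenSuc  zero    _ = 0
whenSuc  (suc _) a = a

whenZero+whenSuc : ∀ r a → a ≡ whenZero r a + whenSuc r a
whenZero+whenSuc zero    a = sym (+-identityʳ a)
whenZero+whenSuc (suc _) a = refl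

whenZero-pos : ∀ {r} a → 0 < r → whenZero r a ≡ 0
whenZero-pos {suc _} a _ = refl

whenSuc-pos : ∀ {r} a → 0 < r → whenSuc r a ≡ a
whenSuc-pos {suc _} a _ = refl

whenSuc>0 : ∀ {r a} → 0 < whenSuc r a → 0 < r
whenSuc>0 {suc _} _ = s≤s z≤n

-- The arcs the greedy path still wastes when d finished and h live coordinates are hot and m
-- live coordinates end hot: every cooling arc but the last, and every arc finishing a coordinate
-- hot but the first (which changes the label unless a finished coordinate is already hot).
potential : ℕ → ℕ → ℕ → ℕ
potential zero    h m = (h ∸ 1) + (m ∸ 1)
potential (suc _) h m = (h ∸ 1) + m

Decreases : (d h m d' h' m' : ℕ) → Set
Decreases d h m d' h' m' =
  1 + potential d' h' m' ≤ changed (isZero (d + h)) (isZero (d' + h')) + potential d h m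

-- An arc advancing one coordinate, after which r of its letters are left; a, a' and e say
-- whether its letter before and after the arc and its last letter are hot, and (d, h, m) ↦
-- (d', h', m') are the counts of the potential before and after the arc.
record StepLaws (r a a' e d h m d' h' m' : ℕ) : Set where
  constructor laws
  field
    flips : a + a' ≡ 1
    final : r ≡ 0 → a' ≡ e
    done  : d' ≡ d + whenZero r a'
    live  : h' + a ≡ h + whenSuc r a'
    ends  : m' + e ≡ m + whenSuc r e

cool-decreases : ∀ h' m → Decreases 0 (suc h') m 0 h' m
cool-decreases zero    m = ≤-refl
cool-decreases (suc _) m = ≤-refl

+1≡+0 : ∀ {m n} → m + 1 ≡ n + 0 → n ≡ suc m
+1≡+0 {m} {n} eq = trans (sym (+-identityʳ n)) (trans (sym eq) (+-comm m 1))

cool-step : ∀ {r a a' e d h m d' h' m'} → a ≡ 1 → d ≡ 0 → StepLaws r a a' e d h m d' h' m' →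
            d' ≡ 0 × Decreases d h m d' h' m'
cool-step {zero} {h = h} {m} {h' = h'} {m'} refl refl (laws refl final refl live ends)
  with final refl
... | refl with +1≡+0 {h'} {h} live | +-cancelʳ-≡ 0 m' m ends
...   | refl | refl = refl , cool-decreases h' m
cool-step {suc _} {e = e} {h = h} {m} {h' = h'} {m'} refl refl (laws refl _ refl live ends)
  with +1≡+0 {h'} {h} live | +-cancelʳ-≡ e m' m ends
... | refl | refl = refl , cool-decreases h' m

heat-step : ∀ {r a a' e d h m d' h' m'} → 0 < r → a ≡ 0 → d ≡ 0 → h ≡ 0 →
            StepLaws r a a' e d h m d' h' m' → d' ≡ 0 × Decreases d h m d' h' m'
heat-step {suc _} {e = e} {m = m} {h' = h'} {m'} _ refl refl refl (laws refl _ refl live ends)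
  with trans (sym (+-identityʳ h')) live | +-cancelʳ-≡ e m' m ends
... | refl | refl = refl , ≤-refl

finish-step : ∀ {r a a' e d h m d' h' m'} → r ≡ 0 → a ≡ 0 → h ≡ 0 →
              StepLaws r a a' e d h m d' h' m' → h' ≡ 0 × Decreases d h m d' h' m'
finish-step {d = d} {m = m} {h' = h'} {m'} refl refl refl (laws refl final refl live ends)
  with final refl
... | refl with trans (sym (+-identityʳ h')) live | +1≡+0 {m'} {m} ends
...   | refl | refl = refl , finish-decreases d m'
  where
  finish-decreases : ∀ d m' → Decreases d 0 (suc m') (d + 1) 0 m'
  finish-decreases zero    m' = ≤-refl
  finish-decreases (suc _) m' = ≤-refl

-- Paths in D_f(x)

total : ∀ {n} → (Fin n → ℕ → ℕ) → Vertex n → ℕ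
total g k = sumF (λ j → g j (k j))

total-cong : ∀ {n} g {k k' : Vertex n} → (∀ j → k j ≡ k' j) → total g k ≡ total g k'
total-cong g k≡k' = sum-cong-≗ (λ j → cong (g j) (k≡k' j))

total-arc : ∀ {n} g {k k' : Vertex n} i → k' i ≡ suc (k i) → (∀ j → j ≢ i → k' j ≡ k j) →
            total g k' + g i (k i) ≡ total g k + g i (suc (k i))
total-arc g {k} i k'i≡ same =
  trans (sum-update _ _ i (λ j j≢i → cong (g j) (same j j≢i))) (cong (λ s → total g k + g i s) k'i≡)

module _ {n : ℕ} (x : TVec n) where

  len : Fin n → ℕ
  len j = length (word (x j))

  rem : Fin n → ℕ → ℕ
  rem j s = len j ∸ s

  remaining : Vertex n → ℕ
  remaining = total rem

  letter-flips : ∀ i {s} → 0 < s → s < len i → at (word (x i)) s ≢ at (word (x i)) (s ∸ 1)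
  letter-flips i {suc s} _ s<len = at-alternates (alternating (x i)) s s<len

  Step : Vertex n → Vertex n → Set
  Step k k' = IsPrefix x k × Arc k k' × IsPrefix x k'

  step-remaining : ∀ {k k'} → Step k k' → remaining k ≡ suc (remaining k')
  step-remaining {k} {k'} (_ , (i , k'i≡ , same) , pk') = +-cancelʳ-≡ (rem i (suc (k i))) _ _ (begin
    remaining k + rem i (suc (k i))         ≡⟨ total-arc rem i k'i≡ same ⟨
    remaining k' + rem i (k i)              ≡⟨ cong (remaining k' +_) (m∸n≡1+[m∸1+n] room) ⟩
    remaining k' + suc (rem i (suc (k i)))  ≡⟨ +-suc (remaining k') _ ⟩
    suc (remaining k') + rem i (suc (k i))  ∎)
    where
    open ≡-Reasoning
    room : k i < len i
    room = subst (_≤ len i) k'i≡ (proj₂ (pk' i))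

  step-flips : ∀ {k k'} → Step k k' →
               ∃ λ i → (ωv x k' i ≡ not (ωv x k i)) × (∀ j → j ≢ i → ωv x k' j ≡ ωv x k j)
  step-flips {k} {k'} (pk , (i , k'i≡ , same) , pk') =
    i , flip , λ j j≢i → cong (λ s → at (word (x j)) (s ∸ 1)) (same j j≢i)
    where
    flip : ωv x k' i ≡ not (ωv x k i)
    flip = subst (λ s → at (word (x i)) (s ∸ 1) ≡ not (ωv x k i)) (sym k'i≡)
             (¬-not (letter-flips i (proj₁ (pk i)) (subst (_≤ len i) k'i≡ (proj₂ (pk' i)))))

  step-xorF : ∀ {k k'} → Step k k' → xorF (ωv x k) ≢ xorF (ωv x k')
  step-xorF st with step-flips st
  ... | i , flip , same = λ eq → not-¬ refl (trans eq (xorF-flip i flip same))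

  record Route (k : Vertex n) : Set where
    constructor route
    field
      next     : List (Vertex n)
      prefixes : AllV (IsPrefix x) (k ∷ next)
      arcs     : Consecutive (k ∷ next)
      ends     : lastV (k ∷ next) (fullV x)
  open Route

  route-steps : ∀ {k} (ρ : Route k) → Linked Step (k ∷ next ρ)
  route-steps (route [] _ _ _) = [-]
  route-steps (route (_ ∷ ks) (a∷ pk ps@(a∷ pk' _)) (c∷ arc arcs) end) =
    (pk , arc , pk') ∷ route-steps (route ks ps arcs end)

  remaining-full : ∀ {k} → (∀ j → k j ≡ len j) → remaining k ≡ 0
  remaining-full k≡len =
    trans (sum-cong-≗ λ j → trans (cong (len j ∸_) (k≡len j)) (n∸n≡0 (len j)))
          (sum-replicate-zero n)

  length-route : ∀ {k} (ρ : Route k) → length (next ρ) ≡ remaining k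
  length-route (route [] _ _ end) = sym (remaining-full end)
  length-route (route (_ ∷ ks) (a∷ pk ps@(a∷ pk' _)) (c∷ arc arcs) end) =
    trans (cong suc (length-route (route ks ps arcs end)))
          (sym (step-remaining (pk , arc , pk')))

  last⁺-route : ∀ {A : Set} (g : Vertex n → A) →
                (∀ {k k'} → (∀ j → k j ≡ k' j) → g k ≡ g k') →
                ∀ {k} (ρ : Route k) → last⁺ (g k) (mapL g (next ρ)) ≡ g (fullV x)
  last⁺-route g g-cong (route [] _ _ end) = g-cong end
  last⁺-route g g-cong (route (_ ∷ ks) (a∷ _ ps) (c∷ _ arcs) end) =
    last⁺-route g g-cong (route ks ps arcs end)

  xorF-path : (P : Path x) → Δpath xorF x P ≡ Δ x
  xorF-path record { verts = [] ; starts = () }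
  xorF-path record { verts = k ∷ ks ; prefixes = ps ; arcs = as ; starts = k≡1 ; ends = end } =
    begin
    length (contraction (mapL L (k ∷ ks))) ∸ 1  ≡⟨ length-contraction (mapL L (k ∷ ks)) ⟩
    changes (mapL L (k ∷ ks))                   ≡⟨ changes-alternating
                                                     (Linked-mapL L step-xorF (route-steps ρ)) ⟩
    length (mapL L ks)                          ≡⟨ length-mapL L ks ⟩
    length ks                                   ≡⟨ length-route ρ ⟩
    remaining k                                 ≡⟨ total-cong rem k≡1 ⟩
    Δ x                                         ∎
    where
    open ≡-Reasoning
    L : Vertex n → Bool
    L k = xorF (ωv x k)
    ρ : Route k
    ρ = route ks ps as end

  module _ (p : Bool) where

    cost : ℕ
    cost = (count p (α x) ∸ 1) + (count p (ω x) ∸ 1)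

    hot : Fin n → ℕ → ℕ
    hot j s = agree p (at (word (x j)) (s ∸ 1))

    countAt : Vertex n → ℕ
    countAt = total hot

    countAt-start : ∀ {k} → (∀ j → k j ≡ 1) → countAt k ≡ count p (α x)
    countAt-start k≡1 =
      trans (total-cong hot k≡1) (sum-cong-≗ λ j → cong (agree p) (at-first (word (x j))))

    countAt-full : countAt (fullV x) ≡ count p (ω x)
    countAt-full = sum-cong-≗ λ j → cong (agree p) (at-last (word (x j)))

    step-countAt : ∀ {k k'} → Step k k' → WithinOne (countAt k) (countAt k')
    step-countAt st with step-flips st
    ... | i , _ , same = count-withinOne p i same

    Δpath-none : (P : Path x) → Δpath (none p) x P ≡ changes (mapL isZero (mapL countAt (verts P)))
    Δpath-none P = trans (length-contraction (labels (none p) x P))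
                         (cong changes (sym (mapL-∘ isZero countAt (verts P))))

    count-α+ω≤Δ : Proper x → count p (α x) + count p (ω x) ≤ Δ x
    count-α+ω≤Δ proper =
      ≤-trans (≤-reflexive (sym (∑-distrib-+ (agree p ∘ α x) (agree p ∘ ω x))))
              (sum-mono-≤ λ j → agree-first+last≤Δ p (alternating (x j)) (proper j))

    route-upper : Proper x → ∀ {k} → (∀ j → k j ≡ 1) → (ρ : Route k) →
                  changes (mapL isZero (mapL countAt (k ∷ next ρ))) + cost ≤ Δ x
    route-upper proper {k} k≡1 ρ
      with changes-isZero-bound (Linked-mapL {S = WithinOne} countAt step-countAt (route-steps ρ))
    ... | inj₁ no-change = begin
      C + cost                       ≡⟨ cong (_+ cost) no-change ⟩
      cost                           ≤⟨ +-mono-≤ (m∸n≤m (count p (α x)) 1) (m∸n≤m (count p (ω x)) 1) ⟩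
      count p (α x) + count p (ω x)  ≤⟨ count-α+ω≤Δ proper ⟩
      Δ x                            ∎
      where
      open ≤-Reasoning
      C : ℕ
      C = changes (mapL isZero (mapL countAt (k ∷ next ρ)))
    ... | inj₂ bound = begin
      C + cost                                          ≡⟨ +-assoc C _ _ ⟨
      C + (count p (α x) ∸ 1) + (count p (ω x) ∸ 1)    ≡⟨ cong₂ (λ a b → C + (a ∸ 1) + (b ∸ 1))
                                                             (sym (countAt-start k≡1)) (sym last≡) ⟩
      C + (countAt k ∸ 1) + (last⁺ (countAt k) cs ∸ 1) ≤⟨ bound ⟩
      length cs                                         ≡⟨ length-mapL countAt (next ρ) ⟩
      length (next ρ)                                   ≡⟨ length-route ρ ⟩
      remaining k                                       ≡⟨ total-cong rem k≡1 ⟩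
      Δ x                                               ∎
      where
      open ≤-Reasoning
      cs : List ℕ
      cs = mapL countAt (next ρ)
      C : ℕ
      C = changes (mapL isZero (countAt k ∷ cs))
      last≡ : last⁺ (countAt k) cs ≡ count p (ω x)
      last≡ = trans (last⁺-route countAt (total-cong hot) ρ) countAt-full

    none-upper : Proper x → (P : Path x) → Δpath (none p) x P + cost ≤ Δ x
    none-upper proper record { verts = [] ; starts = () }
    none-upper proper
               P@record { verts = k ∷ ks ; prefixes = ps ; arcs = as ; starts = k≡1 ; ends = end } =
      subst (λ c → c + cost ≤ Δ x) (sym (Δpath-none P)) (route-upper proper k≡1 (route ks ps as end))

    -- The greedy path
    hotDone hotLive endsHot : Vertex n → ℕ
    hotDone = total λ j s → whenZero (rem j s) (hot j s)
    hotLive = total λ j s → whenSuc (rem j s) (hot j s)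
    endsHot = total λ j s → whenSuc (rem j s) (hot j (len j))

    countAt≡done+live : ∀ k → countAt k ≡ hotDone k + hotLive k
    countAt≡done+live k = trans (sum-cong-≗ λ j → whenZero+whenSuc (rem j (k j)) (hot j (k j)))
                                (∑-distrib-+ (λ j → whenZero (rem j (k j)) (hot j (k j)))
                                             (λ j → whenSuc (rem j (k j)) (hot j (k j))))

    Φ : Vertex n → ℕ
    Φ k = potential (hotDone k) (hotLive k) (endsHot k)

    ΦDecreases : Vertex n → Vertex n → Set
    ΦDecreases k k' = 1 + Φ k' ≤ changed (isZero (countAt k)) (isZero (countAt k')) + Φ k

    Φ-decreases : ∀ {k k'} →
                  Decreases (hotDone k) (hotLive k) (endsHot k) (hotDone k') (hotLive k') (endsHot k') →
                  ΦDecreases k k'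
    Φ-decreases {k} {k'} = subst₂ (λ c c' → 1 + Φ k' ≤ changed (isZero c) (isZero c') + Φ k)
                                  (sym (countAt≡done+live k)) (sym (countAt≡done+live k'))

    Inv : Vertex n → Set
    Inv k = hotDone k ≡ 0 ⊎ (hotLive k ≡ 0 × ∀ j → rem j (k j) ≤ 1)

    module Advance {k : Vertex n} (pk : IsPrefix x k) (i : Fin n) (room : k i < len i) where

      k' : Vertex n
      k' = updateAt k i suc

      pk' : IsPrefix x k'
      pk' j with j ≟F i
      ... | yes refl = subst (λ s → 1 ≤ s × s ≤ len i) (sym (updateAt-updates i k)) (s≤s z≤n , room)
      ... | no j≢i   = subst (λ s → 1 ≤ s × s ≤ len j) (sym (updateAt-minimal j i k j≢i)) (pk j)

      step : Step k k'
      step = pk , (i , updateAt-updates i k , λ j j≢i → updateAt-minimal j i k j≢i) , pk'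

      r' : ℕ
      r' = rem i (suc (k i))

      rem≡ : rem i (k i) ≡ suc r'
      rem≡ = m∸n≡1+[m∸1+n] room

      arc-total : ∀ g → total g k' + g i (k i) ≡ total g k + g i (suc (k i))
      arc-total g = total-arc g i (updateAt-updates i k) (λ j j≢i → updateAt-minimal j i k j≢i)

      a a' e : ℕ
      a  = hot i (k i)
      a' = hot i (suc (k i))
      e  = hot i (len i)

      step-laws : StepLaws r' a a' e (hotDone k) (hotLive k) (endsHot k)
                                     (hotDone k') (hotLive k') (endsHot k')
      step-laws = record
        { flips = agree-≢ p (letter-flips i (proj₁ (pk i)) room ∘ sym)
        ; final = λ r'≡0 → cong (hot i) (≤-antisym room (m∸n≡0⇒m≤n r'≡0))
        ; done  = trans (sym (+-identityʳ _))
                        (subst (λ r → hotDone k' + whenZero r a ≡ hotDone k + whenZero r' a') rem≡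
                               (arc-total λ j s → whenZero (rem j s) (hot j s)))
        ; live  = subst (λ r → hotLive k' + whenSuc r a ≡ hotLive k + whenSuc r' a') rem≡
                        (arc-total λ j s → whenSuc (rem j s) (hot j s))
        ; ends  = subst (λ r → endsHot k' + whenSuc r e ≡ endsHot k + whenSuc r' e) rem≡
                        (arc-total λ j s → whenSuc (rem j s) (hot j (len j)))
        }

      live-term : whenSuc (rem i (k i)) a ≡ a
      live-term = cong (λ r → whenSuc r a) rem≡

      live≡0⇒cold : hotLive k ≡ 0 → a ≡ 0
      live≡0⇒cold h≡0 = trans (sym live-term) (sum≡0⇒term≡0 _ i h≡0)

      cooling : hotDone k ≡ 0 → a ≡ 1 → Inv k' × ΦDecreases k k'
      cooling d≡0 a≡1 with cool-step a≡1 d≡0 step-laws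
      ... | d'≡0 , dec = inj₁ d'≡0 , Φ-decreases {k} {k'} dec

      heating : hotDone k ≡ 0 → hotLive k ≡ 0 → 0 < r' → Inv k' × ΦDecreases k k'
      heating d≡0 h≡0 r'>0 with heat-step r'>0 (live≡0⇒cold h≡0) d≡0 h≡0 step-laws
      ... | d'≡0 , dec = inj₁ d'≡0 , Φ-decreases {k} {k'} dec

      finishing : hotLive k ≡ 0 → r' ≡ 0 → (∀ j → rem j (k j) ≤ 1) → Inv k' × ΦDecreases k k'
      finishing h≡0 r'≡0 rem≤1 with finish-step r'≡0 (live≡0⇒cold h≡0) h≡0 step-laws
      ... | h'≡0 , dec = inj₂ (h'≡0 , rem'≤1) , Φ-decreases {k} {k'} dec
        where
        rem'≤1 : ∀ j → rem j (k' j) ≤ 1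
        rem'≤1 j with j ≟F i
        ... | yes refl = subst (λ s → rem i s ≤ 1) (sym (updateAt-updates i k))
                               (subst (_≤ 1) (sym r'≡0) z≤n)
        ... | no j≢i   = subst (λ s → rem j s ≤ 1) (sym (updateAt-minimal j i k j≢i)) (rem≤1 j)

    Extension : Vertex n → Set
    Extension k =
      Σ (Route k) λ ρ → remaining k ≤ changes (mapL isZero (mapL countAt (k ∷ next ρ))) + Φ k

    extend-by : ∀ {k k'} → Step k k' → ΦDecreases k k' → Extension k' → Extension k
    extend-by {k} {k'} st@(pk , arc , _) dec (route ks ps arcs end , bound) =
      route (k' ∷ ks) (a∷ pk ps) (c∷ arc arcs) end , (begin
        remaining k          ≡⟨ step-remaining st ⟩
        suc (remaining k')   ≤⟨ s≤s bound ⟩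
        suc (C + Φ k')       ≡⟨ +-suc C (Φ k') ⟨
        C + (1 + Φ k')       ≤⟨ +-monoʳ-≤ C dec ⟩
        C + (D + Φ k)        ≡⟨ shuffle C D (Φ k) ⟩
        D + C + Φ k          ∎)
      where
      open ≤-Reasoning
      C D : ℕ
      C = changes (mapL isZero (mapL countAt (k' ∷ ks)))
      D = changed (isZero (countAt k)) (isZero (countAt k'))
      shuffle : ∀ a b c → a + (b + c) ≡ b + a + c
      shuffle = solve-∀

    Extendable : ℕ → Set
    Extendable N = ∀ k → IsPrefix x k → remaining k ≡ N → Inv k → Extension k

    advance : ∀ {N k} (pk : IsPrefix x k) i (room : k i < len i) → remaining k ≡ suc N →
              Inv (Advance.k' pk i room) × ΦDecreases k (Advance.k' pk i room) →
              Extendable N → Extension k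
    advance {N} {k} pk i room remaining≡ (inv' , dec) extend' =
      extend-by step dec (extend' k' pk' remaining' inv')
      where
      open Advance pk i room
      remaining' : remaining k' ≡ N
      remaining' = suc-injective (trans (sym (step-remaining step)) remaining≡)

    room-of : ∀ (k : Vertex n) j → 0 < rem j (k j) → k j < len j
    room-of _ _ rem>0 = m∸n≢0⇒n<m (n>0⇒n≢0 rem>0)

    cool-somewhere : ∀ {N k} → IsPrefix x k → remaining k ≡ suc N →
                     hotDone k ≡ 0 → hotLive k ≢ 0 → Extendable N → Extension k
    cool-somewhere {k = k} pk remaining≡ d≡0 h≢0 with sum>0⇒term>0 _ (n≢0⇒n>0 h≢0)
    ... | i , live>0 = advance pk i room remaining≡ (cooling d≡0 a≡1)
      where
      room : k i < len i
      room = room-of k i (whenSuc>0 {rem i (k i)} live>0)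
      open Advance pk i room
      a≡1 : a ≡ 1
      a≡1 = ≤-antisym (agree≤1 p _) (subst (0 <_) live-term live>0)

    heat-at : ∀ {N k} → IsPrefix x k → remaining k ≡ suc N → hotDone k ≡ 0 → hotLive k ≡ 0 →
              ∀ i → 2 ≤ rem i (k i) → Extendable N → Extension k
    heat-at {k = k} pk remaining≡ d≡0 h≡0 i 2≤rem =
      advance pk i room remaining≡ (heating d≡0 h≡0 r'>0)
      where
      room : k i < len i
      room = room-of k i (≤-trans (s≤s z≤n) 2≤rem)
      open Advance pk i room
      r'>0 : 0 < r'
      r'>0 = ≤-pred (subst (2 ≤_) rem≡ 2≤rem)

    finish-somewhere : ∀ {N k} → IsPrefix x k → remaining k ≡ suc N → hotLive k ≡ 0 →
                       (∀ j → rem j (k j) ≤ 1) → Extendable N → Extension k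
    finish-somewhere {k = k} pk remaining≡ h≡0 rem≤1
      with sum>0⇒term>0 (λ j → rem j (k j)) (subst (0 <_) (sym remaining≡) (s≤s z≤n))
    ... | i , rem>0 = advance pk i room remaining≡ (finishing h≡0 r'≡0 rem≤1)
      where
      room : k i < len i
      room = room-of k i rem>0
      open Advance pk i room
      r'≡0 : r' ≡ 0
      r'≡0 = n≤0⇒n≡0 (≤-pred (subst (_≤ 1) rem≡ (rem≤1 i)))

    extend : ∀ N → Extendable N
    extend zero k pk remaining≡0 _ =
      route [] (a∷ pk a[]) c[ k ] full , subst (_≤ Φ k) (sym remaining≡0) z≤n
      where
      full : ∀ j → k j ≡ len j
      full j = ≤-antisym (proj₂ (pk j)) (m∸n≡0⇒m≤n (sum≡0⇒term≡0 _ j remaining≡0))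
    extend (suc N) k pk remaining≡ inv with hotDone k ≟ 0 | hotLive k ≟ 0 | inv
    ... | yes d≡0 | no h≢0 | _ = cool-somewhere pk remaining≡ d≡0 h≢0 (extend N)
    ... | no d≢0  | _      | inj₁ d≡0 = contradiction d≡0 d≢0
    ... | no _    | _      | inj₂ (h≡0 , rem≤1) =
      finish-somewhere pk remaining≡ h≡0 rem≤1 (extend N)
    ... | yes d≡0 | yes h≡0 | _ with any? (λ j → 2 ≤? rem j (k j))
    ...   | yes (i , 2≤rem) = heat-at pk remaining≡ d≡0 h≡0 i 2≤rem (extend N)
    ...   | no no-2≤rem     =
      finish-somewhere pk remaining≡ h≡0 (λ j → ≤-pred (≰⇒> (no-2≤rem ∘ (j ,_)))) (extend N)

    start-prefix : Proper x → IsPrefix x (startV x)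
    start-prefix proper j = s≤s z≤n , ≤-trans (proper j) (m∸n≤m (len j) 1)

    hotDone-start : Proper x → hotDone (startV x) ≡ 0
    hotDone-start proper =
      trans (sum-cong-≗ λ j → whenZero-pos (hot j 1) (proper j)) (sum-replicate-zero n)

    hotLive-start : Proper x → hotLive (startV x) ≡ count p (α x)
    hotLive-start proper =
      sum-cong-≗ λ j → trans (whenSuc-pos _ (proper j)) (cong (agree p) (at-first (word (x j))))

    endsHot-start : Proper x → endsHot (startV x) ≡ count p (ω x)
    endsHot-start proper =
      sum-cong-≗ λ j → trans (whenSuc-pos _ (proper j)) (cong (agree p) (at-last (word (x j))))

    Φ-start : Proper x → Φ (startV x) ≡ cost
    Φ-start proper =
      trans (cong (λ d → potential d (hotLive (startV x)) (endsHot (startV x))) (hotDone-start proper))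
            (cong₂ (λ h m → (h ∸ 1) + (m ∸ 1)) (hotLive-start proper) (endsHot-start proper))

    none-lower : Proper x → Σ (Path x) λ P → Δ x ≤ Δpath (none p) x P + cost
    none-lower proper
      with extend (Δ x) (startV x) (start-prefix proper) refl (inj₁ (hotDone-start proper))
    ... | route ks ps as end , bound = P , (begin
      Δ x                                                 ≤⟨ bound ⟩
      changes (mapL isZero (mapL countAt (verts P))) + Φ (startV x)
                                                          ≡⟨ cong₂ _+_ (sym (Δpath-none P)) (Φ-start proper) ⟩
      Δpath (none p) x P + cost                           ∎)
      where
      open ≤-Reasoning
      P : Path x
      P = record { verts = startV x ∷ ks ; prefixes = ps ; arcs = as ; starts = λ _ → refl ; ends = end }

    none-cost : Proper x → HasCost (none p) x cost
    none-cost proper = (P , ≤-antisym (none-upper proper P) lower) , none-upper proper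
      where
      P : Path x
      P = proj₁ (none-lower proper)
      lower : Δ x ≤ Δpath (none p) x P + cost
      lower = proj₂ (none-lower proper)

  xor-cost : Proper x → HasCost xorF x 0
  xor-cost proper = (P , optimal P) , ≤-reflexive ∘ optimal
    where
    P : Path x
    P = proj₁ (none-lower true proper)
    optimal : ∀ P → Δpath xorF x P + 0 ≡ Δ x
    optimal P = trans (+-identityʳ _) (xorF-path P)

  Δpath-cong : ∀ {f g : BoolFun n} → (∀ b → f b ≡ g b) → ∀ P → Δpath f x P ≡ Δpath g x P
  Δpath-cong f≡g P =
    cong (λ w → length (contraction w) ∸ 1) (mapL-cong (λ k → f≡g (ωv x k)) (verts P))

  Δpath-not : ∀ (f : BoolFun n) P → Δpath (not ∘ f) x P ≡ Δpath f x P
  Δpath-not f P = begin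
    length (contraction (labels (not ∘ f) x P)) ∸ 1  ≡⟨ length-contraction (labels (not ∘ f) x P) ⟩
    changes (labels (not ∘ f) x P)                   ≡⟨ changes-mapL-not (λ k → f (ωv x k)) (verts P) ⟩
    changes (labels f x P)                           ≡⟨ length-contraction (labels f x P) ⟨
    length (contraction (labels f x P)) ∸ 1          ∎
    where open ≡-Reasoning

  HasCost-resp : ∀ {f g : BoolFun n} {c} → (∀ P → Δpath f x P ≡ Δpath g x P) →
                 HasCost f x c → HasCost g x c
  HasCost-resp {c = c} f≡g ((P , optimal) , bound) =
    (P , trans (cong (_+ c) (sym (f≡g P))) optimal) ,
    λ Q → subst (λ d → d + c ≤ Δ x) (f≡g Q) (bound Q)

theorem1 : (n : ℕ) → 1 ≤ n → (x : TVec n) → Proper x →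
    HasCost xorF x 0 ×
    HasCost orF x ((u (α x) ∸ 1) + (u (ω x) ∸ 1)) ×
    HasCost andF x ((z (α x) ∸ 1) + (z (ω x) ∸ 1))
theorem1 _ _ x proper = xor-cost x proper , or-cost , and-cost
  where
  or-cost : HasCost orF x (cost x true)
  or-cost = HasCost-resp x {none true} {orF}
    (λ P → sym (trans (Δpath-cong x orF≡not-none P) (Δpath-not x (none true) P)))
    (none-cost x true proper)
  and-cost : HasCost andF x (cost x false)
  and-cost = HasCost-resp x {none false} {andF} (λ P → sym (Δpath-cong x andF≡none P))
    (none-cost x false proper)
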